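{- Let $F$ be a CNF formula and $l$ a literal that does not occur in $F$. If $F \cup \{l\}$ is satisfiable, then the single-literal clause $l$ is superirredundant in $F \cup \{l\}$.
   Context: A CNF formula is a finite set of clauses; a clause is a finite set of literals, read as their disjunction. Tautological clauses are not allowed. Resolution: from clauses $c_1 \vee l$ and $c_2 \vee \neg l$ derive $c_1 \vee c_2$; two clauses whose resolvent would be a tautology are considered not to resolve. The resolution closure $\mathrm{ResCn}(F)$ is the set of all clauses obtainable from $F$ by zero or more resolution steps. A clause $c \in F$ is superredundant in $F$ if $\mathrm{ResCn}(F) \setminus \{c\} \models c$, and superirredundant otherwise. -}

module Defs where

open import Data.Nat using (ℕ)
open import Data.Bool using (Bool; true; false; not)
open import Data.List using (List; []; _∷_)
open import Data.List.Membership.Propositional using (_∈_; _∉_)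
open import Data.List.Relation.Unary.All using (All)
open import Data.List.Relation.Unary.Any using (Any)
open import Data.Product using (Σ; _×_; ∃; ∃-syntax)
open import Data.Sum using (_⊎_)
open import Relation.Binary.PropositionalEquality using (_≡_; _≢_)
open import Relation.Nullary using (¬_)

-- A literal: a propositional variable (a natural number) with a polarity
-- (true = positive literal x, false = negative literal ¬x).
record Literal : Set where
  constructor lit
  field
    var  : ℕ
    pos  : Bool
open Literal public

neg : Literal → Literal
neg (lit v b) = lit v (not b)

-- A clause is a finite set of literals, represented by a list read as a set
-- (only membership matters).  A formula is a finite set of clauses,
-- represented as a list.
Clause : Set
Clause = List Literal

Formula : Set
Formula = List Clause

_≈_ : Clause → Clause → Set
c ≈ d = (∀ x → x ∈ c → x ∈ d) × (∀ x → x ∈ d → x ∈ c)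

Tautology : Clause → Set
Tautology c = ∃[ x ] (x ∈ c × neg x ∈ c)

TautologyFree : Formula → Set
TautologyFree F = All (λ c → ¬ Tautology c) F

OccursIn : Literal → Formula → Set
OccursIn l F = Any (λ c → l ∈ c) F

Assignment : Set
Assignment = ℕ → Bool

SatLit : Assignment → Literal → Set
SatLit α (lit v b) = α v ≡ b

SatClause : Assignment → Clause → Set
SatClause α c = Any (SatLit α) c

SatFormula : Assignment → Formula → Set
SatFormula α F = All (SatClause α) F

Satisfiable : Formula → Set
Satisfiable F = ∃[ α ] SatFormula α F

Resolvent : Clause → Clause → Clause → Set
Resolvent c₁ c₂ r =
  ∃[ l ] (l ∈ c₁ × neg l ∈ c₂ ×
          (∀ x → x ∈ r → (x ∈ c₁ × x ≢ l) ⊎ (x ∈ c₂ × x ≢ neg l)) ×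
          (∀ x → (x ∈ c₁ × x ≢ l) ⊎ (x ∈ c₂ × x ≢ neg l) → x ∈ r) ×
          ¬ Tautology r)

data ResCn (F : Formula) : Clause → Set where
  base    : ∀ {c} → c ∈ F → ResCn F c
  resolve : ∀ {c₁ c₂ r} → ResCn F c₁ → ResCn F c₂ → Resolvent c₁ c₂ r → ResCn F r

_⊨_ : (Clause → Set) → Clause → Set
G ⊨ c = ∀ (α : Assignment) → (∀ d → G d → SatClause α d) → SatClause α c

ResCnMinus : Formula → Clause → Clause → Set
ResCnMinus F c d = ResCn F d × ¬ (d ≈ c)

Superredundant : Formula → Clause → Set
Superredundant F c = c ∈ F × (ResCnMinus F c ⊨ c)

Superirredundant : Formula → Clause → Set
Superirredundant F c = c ∈ F × ¬ (ResCnMinus F c ⊨ c)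

{-# OPTIONS --safe #-}
module Submission where

-- Take a model α of F ∪ {l} and let β be α with l made false.  Resolution is
-- sound, so α satisfies every clause of ResCn(F ∪ {l}).  Since l does not occur
-- in F, the only clause of the closure containing l is {l} itself, so every
-- other clause is satisfied by α through a literal different from l, and that
-- literal is still true under β.  Hence β is a model of ResCn(F ∪ {l}) \ {l}
-- falsifying l.

open import Defs
open import Data.Bool using (not)
import Data.Bool.Properties as Bool
open import Data.Nat using (_≟_)
open import Data.List using ([]; _∷_)
open import Data.List.Membership.Propositional using (_∈_; _∉_; find; lose)
open import Data.List.Relation.Unary.Any using (here; there)
open import Data.List.Relation.Unary.Any.Properties using (singleton⁻)
import Data.List.Relation.Unary.All as All
open import Data.Product using (∃-syntax; _×_; _,_; proj₁)
open import Data.Sum using (inj₁; inj₂)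
open import Data.Empty using (⊥-elim)
open import Relation.Nullary using (¬_; Dec; yes; no)
open import Relation.Binary.PropositionalEquality using (_≢_; refl; sym; trans; cong)

satLit? : ∀ α x → Dec (SatLit α x)
satLit? α (lit v b) = α v Bool.≟ b

satLit⇒¬satLit-neg : ∀ {α x} → SatLit α x → ¬ SatLit α (neg x)
satLit⇒¬satLit-neg {x = lit v b} = Bool.not-¬

satClause-avoiding : ∀ {α c p} → SatClause α c → ¬ SatLit α p →
                     ∃[ x ] ((x ∈ c × x ≢ p) × SatLit α x)
satClause-avoiding α⊨c α⊭p with find α⊨c
... | x , x∈c , α⊨x = x , (x∈c , λ { refl → α⊭p α⊨x }) , α⊨x

resolvent-sound : ∀ {α c₁ c₂ r} → SatClause α c₁ → SatClause α c₂ →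
                  Resolvent c₁ c₂ r → SatClause α r
resolvent-sound {α} α⊨c₁ α⊨c₂ (p , _ , _ , _ , into-r , _) with satLit? α p
... | no α⊭p =
  let x , x∈c₁∖p , α⊨x = satClause-avoiding α⊨c₁ α⊭p in lose (into-r x (inj₁ x∈c₁∖p)) α⊨x
... | yes α⊨p =
  let x , x∈c₂∖¬p , α⊨x = satClause-avoiding α⊨c₂ (satLit⇒¬satLit-neg {α} {p} α⊨p)
  in  lose (into-r x (inj₂ x∈c₂∖¬p)) α⊨x

resCn-sound : ∀ {α F d} → SatFormula α F → ResCn F d → SatClause α d
resCn-sound α⊨F (base d∈F)        = All.lookup α⊨F d∈F
resCn-sound α⊨F (resolve d₁ d₂ r) = resolvent-sound (resCn-sound α⊨F d₁) (resCn-sound α⊨F d₂) r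

-- A resolvent could only inherit l from a parent {l}, whose pivot is then l itself.
resCn-∋-unit⇒≈-unit : ∀ {F l d} → ¬ OccursIn l F → ResCn ((l ∷ []) ∷ F) d → l ∈ d →
                      d ≈ (l ∷ [])
resCn-∋-unit⇒≈-unit _   (base (here refl))  _   = (λ _ x∈ → x∈) , (λ _ x∈ → x∈)
resCn-∋-unit⇒≈-unit l∉F (base (there d∈F)) l∈d = ⊥-elim (l∉F (lose d∈F l∈d))
resCn-∋-unit⇒≈-unit l∉F (resolve d₁ d₂ (p , p∈c₁ , ¬p∈c₂ , from-r , _)) l∈d
  with from-r _ l∈d
... | inj₁ (l∈c₁ , l≢p) =
  ⊥-elim (l≢p (sym (singleton⁻ (proj₁ (resCn-∋-unit⇒≈-unit l∉F d₁ l∈c₁) p p∈c₁))))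
... | inj₂ (l∈c₂ , l≢¬p) =
  ⊥-elim (l≢¬p (sym (singleton⁻ (proj₁ (resCn-∋-unit⇒≈-unit l∉F d₂ l∈c₂) (neg p) ¬p∈c₂))))

falsify : Assignment → Literal → Assignment
falsify α l v with v ≟ var l
... | yes _ = not (pos l)
... | no _  = α v

falsify-falsifies : ∀ α l → ¬ SatLit (falsify α l) l
falsify-falsifies α (lit v b) with v ≟ v
... | yes _  = λ β⊨l → Bool.not-¬ refl (sym β⊨l)
... | no v≢v = ⊥-elim (v≢v refl)

falsify-preserves : ∀ α {l x} → SatLit α l → x ≢ l → SatLit α x → SatLit (falsify α l) x
falsify-preserves α {lit w b} {lit v c} α⊨l x≢l α⊨x with v ≟ w
... | yes refl = ⊥-elim (x≢l (cong (lit v) (trans (sym α⊨x) α⊨l)))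
... | no _     = α⊨x

falsify-preserves-clause : ∀ α {l c} → SatLit α l → l ∉ c → SatClause α c →
                           SatClause (falsify α l) c
falsify-preserves-clause α α⊨l l∉c α⊨c with find α⊨c
... | x , x∈c , α⊨x = lose x∈c (falsify-preserves α α⊨l (λ { refl → l∉c x∈c }) α⊨x)

lemma14 : (F : Formula) → TautologyFree F → (l : Literal) → ¬ OccursIn l F →
          Satisfiable ((l ∷ []) ∷ F) → Superirredundant ((l ∷ []) ∷ F) (l ∷ [])
lemma14 F _ l l∉F (α , α⊨F∪l) =
  here refl , λ rest⊨l → falsify-falsifies α l (singleton⁻ (rest⊨l β β⊨rest))
  where
  β : Assignment
  β = falsify α l

  α⊨l : SatLit α l
  α⊨l = singleton⁻ (All.lookup α⊨F∪l (here refl))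

  β⊨rest : ∀ d → ResCnMinus ((l ∷ []) ∷ F) (l ∷ []) d → SatClause β d
  β⊨rest d (d∈ResCn , d≉l) =
    falsify-preserves-clause α α⊨l (λ l∈d → d≉l (resCn-∋-unit⇒≈-unit l∉F d∈ResCn l∈d))
                             (resCn-sound α⊨F∪l d∈ResCn)
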